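{- Let $F,G:\mathbf{Sets}\to\mathbf{Sets}$ be functors and $\alpha:F\Rightarrow G$ a natural transformation all of whose components are surjective. Let $b_1:X\to GX$, $b_2:Y\to GY$ be $G$-coalgebras and $R\subseteq X\times Y$ a $G$-bisimulation between them that is near injective, i.e. $|\{b_2(y)\mid(x,y)\in R\}|\le1$ for all $x\in X$ and $|\{b_1(x)\mid(x,y)\in R\}|\le1$ for all $y\in Y$. Then there exist $a_1:X\to FX$ and $a_2:Y\to FY$ with $\alpha_X\circ a_1=b_1$ and $\alpha_Y\circ a_2=b_2$ such that $R$ is an $F$-bisimulation between $a_1$ and $a_2$.
   Context: For a functor $F$ and $R\subseteq X\times Y$ with projections $r_1,r_2$, $\mathrm{Rel}(F)(R)=\{(u,v)\in FX\times FY\mid\exists w\in FR.\ Fr_1(w)=u,\ Fr_2(w)=v\}$. $R$ is an $F$-bisimulation between coalgebras $c:X\to FX$ and $d:Y\to FY$ if $(x,y)\in R$ implies $(c(x),d(y))\in\mathrm{Rel}(F)(R)$. A natural transformation is a family $\alpha_X:FX\to GX$ with $Gf\circ\alpha_X=\alpha_Y\circ Ff$. -}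

module Defs where

open import Level using (Level; suc; zero)
open import Data.Product using (Σ; ∃; _×_; _,_; proj₁; proj₂)
open import Function using (_∘_; id)
open import Relation.Binary.PropositionalEquality using (_≡_)

record SetFunctor : Set₁ where
  field
    F₀      : Set → Set
    map     : {A B : Set} → (A → B) → F₀ A → F₀ B
    map-id  : {A : Set} (u : F₀ A) → map id u ≡ u
    map-∘   : {A B C : Set} (g : B → C) (f : A → B) (u : F₀ A) →
              map (g ∘ f) u ≡ map g (map f u)
open SetFunctor public

record NatTrans (F G : SetFunctor) : Set₁ where
  field
    cmp : (A : Set) → F₀ F A → F₀ G A
    nat : {A B : Set} (f : A → B) (u : F₀ F A) →
          map G f (cmp A u) ≡ cmp B (map F f u)
open NatTrans public

Relation : Set → Set → Set₁
Relation X Y = X → Y → Set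

Graph : {X Y : Set} → Relation X Y → Set
Graph {X} {Y} R = Σ (X × Y) (λ p → R (proj₁ p) (proj₂ p))

r₁ : {X Y : Set} {R : Relation X Y} → Graph R → X
r₁ ((x , _) , _) = x

r₂ : {X Y : Set} {R : Relation X Y} → Graph R → Y
r₂ ((_ , y) , _) = y

RelLift : (F : SetFunctor) {X Y : Set} → Relation X Y → Relation (F₀ F X) (F₀ F Y)
RelLift F R u v = Σ (F₀ F (Graph R)) λ w → (map F r₁ w ≡ u) × (map F r₂ w ≡ v)

Coalg : SetFunctor → Set → Set
Coalg F X = X → F₀ F X

IsBisimulation : (F : SetFunctor) {X Y : Set} → Coalg F X → Coalg F Y → Relation X Y → Set
IsBisimulation F {X} {Y} c d R = (x : X) (y : Y) → R x y → RelLift F R (c x) (d y)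

Surjective : {A B : Set} → (A → B) → Set
Surjective {A} {B} f = (b : B) → Σ A λ a → f a ≡ b

NearInjective : (G : SetFunctor) {X Y : Set} → Coalg G X → Coalg G Y → Relation X Y → Set
NearInjective G {X} {Y} b₁ b₂ R =
  ((x : X) (y y′ : Y) → R x y → R x y′ → b₂ y ≡ b₂ y′) ×
  ((y : Y) (x x′ : X) → R x y → R x′ y → b₁ x ≡ b₁ x′)

{-# OPTIONS --safe #-}
module Submission where

-- Excluded middle recomputes a proof of (u , v) ∈ Rel(G)(R) from an irrelevant
-- one, giving a G-witness that depends only on the pair (u , v); lift it along a
-- section of α.  Set a₁ x to be the
-- first projection of the lifted witness for (b₁ x , b₂ y) with any partner y of x
-- (and any α-preimage of b₁ x if x has no partner), and a₂ symmetrically.  Near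
-- injectivity says b₂ y, resp. b₁ x, does not depend on the partner chosen, so for
-- every related pair x R y the lifted witness for (b₁ x , b₂ y) has projections
-- a₁ x and a₂ y.

open import Defs
open import Level using (zero)
open import Axiom.ExcludedMiddle using (ExcludedMiddle)
open import Data.Product using (Σ; ∃; _×_; _,_; proj₁; proj₂)
open import Relation.Nullary using (Dec; yes; no; contradiction)
open import Relation.Nullary.Decidable using (recompute)
open import Relation.Binary.PropositionalEquality
  using (_≡_; refl; sym; trans; cong; module ≡-Reasoning)

module SurjectiveNatTrans {F G : SetFunctor} (α : NatTrans F G)
    (α-surjective : (A : Set) → Surjective (cmp α A)) where

  section : (A : Set) → F₀ G A → F₀ F A
  section A w = proj₁ (α-surjective A w)

  cmp-section : (A : Set) (w : F₀ G A) → cmp α A (section A w) ≡ w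
  cmp-section A w = proj₂ (α-surjective A w)

  cmp-map-section : {A B : Set} (f : A → B) (w : F₀ G A) →
                    cmp α B (map F f (section A w)) ≡ map G f w
  cmp-map-section {A} {B} f w = begin
    cmp α B (map F f (section A w))  ≡⟨ sym (nat α f (section A w)) ⟩
    map G f (cmp α A (section A w))  ≡⟨ cong (map G f) (cmp-section A w) ⟩
    map G f w                        ∎
    where open ≡-Reasoning

  module LiftedWitness (em : ExcludedMiddle zero) {X Y : Set} (R : Relation X Y) where

    liftWitness : {u : F₀ G X} {v : F₀ G Y} → .(RelLift G R u v) → F₀ F (Graph R)
    liftWitness e = section (Graph R) (proj₁ (recompute em e))

    liftWitness-cong : {u u′ : F₀ G X} {v v′ : F₀ G Y} → u ≡ u′ → v ≡ v′ →
                       .(e : RelLift G R u v) .(e′ : RelLift G R u′ v′) →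
                       liftWitness e ≡ liftWitness e′
    liftWitness-cong refl refl e e′ = refl

    cmp-map-r₁-liftWitness : {u : F₀ G X} {v : F₀ G Y} (e : RelLift G R u v) →
                             cmp α X (map F r₁ (liftWitness e)) ≡ u
    cmp-map-r₁-liftWitness e with recompute em e
    ... | w , r₁w≡u , _ = trans (cmp-map-section r₁ w) r₁w≡u

    cmp-map-r₂-liftWitness : {u : F₀ G X} {v : F₀ G Y} (e : RelLift G R u v) →
                             cmp α Y (map F r₂ (liftWitness e)) ≡ v
    cmp-map-r₂-liftWitness e with recompute em e
    ... | w , _ , r₂w≡v = trans (cmp-map-section r₂ w) r₂w≡v

module Construction (em : ExcludedMiddle zero)
    {F G : SetFunctor} (α : NatTrans F G)
    (α-surjective : (A : Set) → Surjective (cmp α A))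
    {X Y : Set} {b₁ : Coalg G X} {b₂ : Coalg G Y} {R : Relation X Y}
    (bisim : IsBisimulation G b₁ b₂ R) where

  open SurjectiveNatTrans α α-surjective
  open LiftedWitness em R

  lift₁ : (x : X) → Dec (∃ (R x)) → F₀ F X
  lift₁ x (yes (y , xRy)) = map F r₁ (liftWitness (bisim x y xRy))
  lift₁ x (no _)          = section X (b₁ x)

  lift₂ : (y : Y) → Dec (∃ λ x → R x y) → F₀ F Y
  lift₂ y (yes (x , xRy)) = map F r₂ (liftWitness (bisim x y xRy))
  lift₂ y (no _)          = section Y (b₂ y)

  a₁ : Coalg F X
  a₁ x = lift₁ x em

  a₂ : Coalg F Y
  a₂ y = lift₂ y em

  cmp-lift₁ : (x : X) (d : Dec (∃ (R x))) → cmp α X (lift₁ x d) ≡ b₁ x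
  cmp-lift₁ x (yes (y , xRy)) = cmp-map-r₁-liftWitness (bisim x y xRy)
  cmp-lift₁ x (no _)          = cmp-section X (b₁ x)

  cmp-lift₂ : (y : Y) (d : Dec (∃ λ x → R x y)) → cmp α Y (lift₂ y d) ≡ b₂ y
  cmp-lift₂ y (yes (x , xRy)) = cmp-map-r₂-liftWitness (bisim x y xRy)
  cmp-lift₂ y (no _)          = cmp-section Y (b₂ y)

  lift-bisimulation : NearInjective G b₁ b₂ R → {x : X} {y : Y} → R x y →
                      (d₁ : Dec (∃ (R x))) (d₂ : Dec (∃ λ x → R x y)) →
                      RelLift F R (lift₁ x d₁) (lift₂ y d₂)
  lift-bisimulation (same₂ , same₁) {x} {y} xRy (yes (y′ , xRy′)) (yes (x′ , x′Ry)) =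
    liftWitness e ,
    cong (map F r₁) (liftWitness-cong refl (same₂ x y y′ xRy xRy′) e (bisim x y′ xRy′)) ,
    cong (map F r₂) (liftWitness-cong (same₁ y x x′ xRy x′Ry) refl e (bisim x′ y x′Ry))
    where e = bisim x y xRy
  lift-bisimulation _ {y = y} xRy (no ¬partner) _ = contradiction (y , xRy) ¬partner
  lift-bisimulation _ {x = x} xRy (yes _) (no ¬partner) = contradiction (x , xRy) ¬partner

proposition6 : ExcludedMiddle zero →
    (F G : SetFunctor) (α : NatTrans F G) →
    ((A : Set) → Surjective (cmp α A)) →
    {X Y : Set} (b₁ : Coalg G X) (b₂ : Coalg G Y) (R : Relation X Y) →
    IsBisimulation G b₁ b₂ R →
    NearInjective G b₁ b₂ R →
    Σ (Coalg F X) λ a₁ → Σ (Coalg F Y) λ a₂ →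
      ((x : X) → cmp α X (a₁ x) ≡ b₁ x) ×
      ((y : Y) → cmp α Y (a₂ y) ≡ b₂ y) ×
      IsBisimulation F a₁ a₂ R
proposition6 em F G α α-surjective b₁ b₂ R bisim nearInjective =
  a₁ , a₂ ,
  (λ x → cmp-lift₁ x em) ,
  (λ y → cmp-lift₂ y em) ,
  (λ x y xRy → lift-bisimulation nearInjective xRy em em)
  where open Construction em α α-surjective bisim
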